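{- Let $P=e_1\ldots e_k$ be a monotone path in $G$ (given as a sequence of arcs, with $e_j=v_jv_{j+1}$). If $P$ is ascending (with respect to the zero schedule), then for every $1<i<k$: if $\bar{s}(i)=k$ then either $e_i\ldots e_k$ or $e_{i+1}\ldots e_k$ is ascending; and if $\underline{s}(i)=1$ then either $e_1\ldots e_i$ or $e_1\ldots e_{i-1}$ is ascending. If $P$ is descending with respect to a charge drop schedule $C=(0,d_2,\ldots,d_{k+1})$, then for every $1<i<k$: if $\bar{s}(i)=k$ then either $e_i\ldots e_k$ or $e_{i+1}\ldots e_k$ is descending with respect to the corresponding suffix schedule (for the subpath starting at $v_j$, the schedule $(0,d_{j+1},\ldots,d_{k+1})$); and if $\underline{s}(i)=1$ then either $e_1\ldots e_i$ or $e_1\ldots e_{i-1}$ is descending with respect to the corresponding prefix schedule (for the subpath ending at $v_j$, the schedule $(0,d_2,\ldots,d_j)$).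
   Context: $G=(V,A,g)$ is a directed graph with real arc gains and $B>0$ is the battery capacity. For a path $Q=u_1\ldots u_m$ and $b\in[0,B]$, $\alpha_b(Q)$ is the final charge when starting at $u_1$ with charge $b$ (traversing $u_iu_{i+1}$ from charge $c$ requires $c+g(u_iu_{i+1})\ge0$ and yields $\min\{c+g(u_iu_{i+1}),B\}$; $-\infty$ if impossible); $Q$ is traversable if $\alpha_B(Q)\ge0$. A charge drop schedule for $Q$ is $C=(0,d_2,\ldots,d_m)\in\mathbb{R}^m_{\ge0}$ with $g^{Q,C}_{u_1}=0$, $g^{Q,C}_{u_i}=\sum_{t=1}^{i-1}g(u_tu_{t+1})-\sum_{t=2}^{i}d_t$; the zero schedule gives $g_{u_i}$. $Q$ is ascending w.r.t. $C$ if traversable and $0\le g^{Q,C}_{u_i}\le g^{Q,C}_{u_m}$ for all $i$; descending w.r.t. $C$ if traversable and $0\ge g^{Q,C}_{u_i}\ge g^{Q,C}_{u_m}$ for all $i$; monotone if either. $Q$ is $u_1u_2$-bounded if either $g(u_1u_2)\ge0$ and $0\le g_{u_i}\le g(u_1u_2)$ for all $i$, or $g(u_1u_2)\le0$ and $g(u_1u_2)\le g_{u_i}\le0$ for all $i$; $Q$ is $u_{m-1}u_m$-bounded if either $g(u_{m-1}u_m)\ge0$ and $g_{u_{m-1}}\le g_{u_i}\le g_{u_m}$ for all $i$, or $g(u_{m-1}u_m)<0$ and $g_{u_m}\le g_{u_i}\le g_{u_{m-1}}$ for all $i$ (all with respect to the zero schedule). For $1\le i\le k$, $\bar{s}(i)\ge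 i$ is the maximal index such that $e_i\ldots e_{\bar{s}(i)}$ is $e_i$-bounded (first arc $e_i$), and $\underline{s}(i)\le i$ is the smallest index such that $e_{\underline{s}(i)}\ldots e_i$ is $e_i$-bounded (last arc $e_i$).
   Formalization: The arc gains, the battery capacity $B$ and the charge drops $d_j$ are rational rather than real. -}

module Defs where

open import Data.Nat as ℕ using (ℕ; zero; suc; _∸_)
open import Data.Rational using (ℚ; 0ℚ; _+_; _-_; _≤_; _<_; _⊓_)
open import Data.Rational.Properties using (_≤?_)
open import Data.List using (List; []; _∷_; _∷ʳ_; map; take; drop; scanl; zipWith; foldr; replicate; length)
open import Data.List.Relation.Unary.All using (All)
open import Data.Maybe using (Maybe; just; nothing; _>>=_)
open import Data.Product using (Σ; _×_; _,_)
open import Data.Sum using (_⊎_)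
open import Data.Empty using (⊥)
open import Data.Unit using (⊤)
open import Relation.Nullary using (¬_; yes; no)
open import Relation.Binary.PropositionalEquality using (_≡_)

record Graph : Set₁ where
  field
    V    : Set
    Arc  : V → V → Set
    gain : ∀ {u v} → Arc u v → ℚ

module _ (G : Graph) where
  open Graph G

  Edge : Set
  Edge = Σ V λ u → Σ V λ v → Arc u v

  tail head : Edge → V
  tail (u , _ , _) = u
  head (_ , v , _) = v

  g : Edge → ℚ
  g (_ , _ , a) = gain a

  IsPath : List Edge → Set
  IsPath []             = ⊥
  IsPath (e ∷ [])       = ⊤
  IsPath (e ∷ f ∷ rest) = (head e ≡ tail f) × IsPath (f ∷ rest)

  gains : List Edge → List ℚ
  gains = map g

-- Battery semantics (capacity B). `nothing` encodes -∞.

step : ℚ → ℚ → ℚ → Maybe ℚ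
step B c x with 0ℚ ≤? (c + x)
... | yes _ = just ((c + x) ⊓ B)
... | no  _ = nothing

alpha : ℚ → ℚ → List ℚ → Maybe ℚ
alpha B b []       = just b
alpha B b (x ∷ xs) = step B b x >>= λ c → alpha B c xs

TraversableG : ℚ → List ℚ → Set
TraversableG B xs = Σ ℚ λ c → (alpha B B xs ≡ just c) × (0ℚ ≤ c)

-- Charge drop schedules. A schedule C = (0,d_2,...,d_m) for a path with
-- arc gains x_1..x_{m-1} is represented by the list ds = d_2 ... d_m.

sum : List ℚ → ℚ
sum = foldr _+_ 0ℚ

-- the values g^{Q,C}_{u_1}, ..., g^{Q,C}_{u_m}
levels : List ℚ → List ℚ → List ℚ
levels xs ds = scanl _+_ 0ℚ (zipWith _-_ xs ds)

final : List ℚ → List ℚ → ℚ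
final xs ds = sum (zipWith _-_ xs ds)

zeroSchedule : List ℚ → List ℚ
zeroSchedule xs = replicate (length xs) 0ℚ

AscendingG : ℚ → List ℚ → List ℚ → Set
AscendingG B xs ds =
  TraversableG B xs × All (λ y → (0ℚ ≤ y) × (y ≤ final xs ds)) (levels xs ds)

DescendingG : ℚ → List ℚ → List ℚ → Set
DescendingG B xs ds =
  TraversableG B xs × All (λ y → (y ≤ 0ℚ) × (final xs ds ≤ y)) (levels xs ds)

FirstBoundedG : List ℚ → Set
FirstBoundedG []         = ⊥
FirstBoundedG (x ∷ rest) =
  ((0ℚ ≤ x) × All (λ y → (0ℚ ≤ y) × (y ≤ x)) (levels (x ∷ rest) (zeroSchedule (x ∷ rest))))
  ⊎ ((x ≤ 0ℚ) × All (λ y → (x ≤ y) × (y ≤ 0ℚ)) (levels (x ∷ rest) (zeroSchedule (x ∷ rest))))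

-- bounded w.r.t. the last arc (zero schedule): xs = pre ++ [x], where
-- g_{u_{m-1}} = sum pre and g_{u_m} = sum pre + x
LastBoundedG : List ℚ → Set
LastBoundedG xs = Σ (List ℚ) λ pre → Σ ℚ λ x → (xs ≡ pre ∷ʳ x) ×
  (((0ℚ ≤ x) × All (λ y → (sum pre ≤ y) × (y ≤ sum pre + x)) (levels xs (zeroSchedule xs)))
   ⊎ ((x < 0ℚ) × All (λ y → (sum pre + x ≤ y) × (y ≤ sum pre)) (levels xs (zeroSchedule xs))))

-- Subpaths (1-based arc indices): e_a ... e_b of a list of arcs.

sub : {A : Set} → ℕ → ℕ → List A → List A
sub a b xs = take (suc b ∸ a) (drop (a ∸ 1) xs)

module _ (G : Graph) (B : ℚ) where

  Traversable : List (Edge G) → Set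
  Traversable Q = TraversableG B (gains G Q)

  Ascending : List (Edge G) → List ℚ → Set
  Ascending Q ds = AscendingG B (gains G Q) ds

  Descending : List (Edge G) → List ℚ → Set
  Descending Q ds = DescendingG B (gains G Q) ds

  IsSchedule : List (Edge G) → List ℚ → Set
  IsSchedule Q ds = (length ds ≡ length Q) × All (0ℚ ≤_) ds

  zeroSch : List (Edge G) → List ℚ
  zeroSch Q = zeroSchedule (gains G Q)

FirstBounded : (G : Graph) → List (Edge G) → Set
FirstBounded G Q = FirstBoundedG (gains G Q)

LastBounded : (G : Graph) → List (Edge G) → Set
LastBounded G Q = LastBoundedG (gains G Q)

SBar : (G : Graph) → List (Edge G) → ℕ → ℕ → Set
SBar G P i j =
  (i ℕ.≤ j) × (j ℕ.≤ length P) × FirstBounded G (sub i j P)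
  × (∀ j′ → j ℕ.< j′ → j′ ℕ.≤ length P → ¬ FirstBounded G (sub i j′ P))

SUnder : (G : Graph) → List (Edge G) → ℕ → ℕ → Set
SUnder G P i j =
  (1 ℕ.≤ j) × (j ℕ.≤ i) × LastBounded G (sub j i P)
  × (∀ j′ → 1 ℕ.≤ j′ → j′ ℕ.< j → ¬ LastBounded G (sub j′ i P))

{-# OPTIONS --safe #-}
-- Traversability passes to every subpath: a prefix is run exactly as
-- inside P, and a suffix started with a full battery ends at least as high as when it is
-- reached along P. Of the level conditions, the bound by the final level is inherited by
-- suffixes and the bound by 0 by prefixes; the bounding arc e_i supplies the missing one.
-- If e_i … e_k is e_i-bounded, all its levels lie on one side of the level at v_i or at v_{i+1},
-- depending on the sign of g(e_i), so one of the two suffixes has levels of the right sign.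
-- If e_1 … e_i is e_i-bounded, the level at v_i or at v_{i+1} is an extremum of all earlier
-- levels, so one of the two prefixes ends at its extreme level. With a charge drop schedule
-- these conditions are checked on the zero-schedule levels and transfer to the scheduled ones,
-- because drops lower each level by at least as much as any earlier one.
module Submission where

open import Defs
open import Data.Nat as ℕ using (ℕ; zero; suc; _∸_; s≤s)
import Data.Nat.Properties as ℕP
open import Data.Fin using (Fin; fromℕ<)
open import Data.Fin.Properties using (toℕ-fromℕ<)
open import Data.Rational using (ℚ; 0ℚ; _+_; _-_; -_; _≤_; _<_; _⊓_)
open import Data.Rational.Properties
  using (_≤?_; ≤-refl; ≤-trans; <⇒≤; +-identityˡ; +-identityʳ; +-assoc;
         +-mono-≤; +-monoˡ-≤; +-monoʳ-≤; neg-antimono-≤; ⊓-glb; ⊓-monoˡ-≤; p⊓q≤q; +-0-group)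
open import Algebra.Properties.Group +-0-group using (\\-leftDividesʳ)
open import Data.List
  using (List; []; _∷_; [_]; _++_; _∷ʳ_; length; take; drop; zipWith; scanl; lookup)
open import Data.List.Properties
  using (take-[]; take-take; take++drop≡id; take-suc; take-all; take-map; drop-map;
         length-drop; length-map; ∷ʳ-injectiveˡ; zipWith-zeroʳ)
open import Data.List.Relation.Unary.All using (All; []; _∷_)
import Data.List.Relation.Unary.All.Properties as All
open import Data.Maybe using (just; nothing)
open import Data.Maybe.Properties using (just-injective)
open import Data.Product using (Σ-syntax; _×_; _,_; proj₁; proj₂)
open import Data.Sum as Sum using (_⊎_; inj₁; inj₂)
open import Function using (_∘_; id)
open import Relation.Nullary using (yes; no; contradiction)
open import Relation.Binary.PropositionalEquality
  using (_≡_; refl; sym; trans; cong; cong₂; subst; subst₂)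

+-cancelˡ-≤ : ∀ r {p q} → r + p ≤ r + q → p ≤ q
+-cancelˡ-≤ r {p} {q} r+p≤r+q =
  subst₂ _≤_ (\\-leftDividesʳ r p) (\\-leftDividesʳ r q) (+-monoʳ-≤ (- r) r+p≤r+q)

p+q≤p⇒q≤0 : ∀ p {q} → p + q ≤ p → q ≤ 0ℚ
p+q≤p⇒q≤0 p {q} p+q≤p = +-cancelˡ-≤ p (subst (p + q ≤_) (sym (+-identityʳ p)) p+q≤p)

p≤p+q⇒0≤q : ∀ p {q} → p ≤ p + q → 0ℚ ≤ q
p≤p+q⇒0≤q p {q} p≤p+q = +-cancelˡ-≤ p (subst (_≤ p + q) (sym (+-identityʳ p)) p≤p+q)

p-q≤p : ∀ p {q} → 0ℚ ≤ q → p - q ≤ p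
p-q≤p p {q} 0≤q = subst (p - q ≤_) (+-identityʳ p) (+-monoʳ-≤ p (neg-antimono-≤ 0≤q))

sum-++ : ∀ xs ys → sum (xs ++ ys) ≡ sum xs + sum ys
sum-++ []       ys = sym (+-identityˡ (sum ys))
sum-++ (x ∷ xs) ys = trans (cong (x +_) (sum-++ xs ys)) (sym (+-assoc x (sum xs) (sum ys)))

sum-∷ʳ : ∀ xs x → sum (xs ∷ʳ x) ≡ sum xs + x
sum-∷ʳ xs x = trans (sum-++ xs [ x ]) (cong (sum xs +_) (+-identityʳ x))

take-suc-init : ∀ {A : Set} {n} (xs : List A) {pre x} → n ℕ.< length xs →
  take (suc n) xs ≡ pre ∷ʳ x → pre ≡ take n xs
take-suc-init xs n<len eq = ∷ʳ-injectiveˡ _ _ (trans (sym eq)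
  (subst (λ m → take (suc m) xs ≡ take m xs ∷ʳ lookup xs i) (toℕ-fromℕ< n<len) (take-suc xs i)))
  where
  i : Fin (length xs)
  i = fromℕ< n<len

take-zipWith : ∀ {A B C : Set} (f : A → B → C) n xs ys →
  take n (zipWith f xs ys) ≡ zipWith f (take n xs) (take n ys)
take-zipWith f zero    xs       ys       = refl
take-zipWith f (suc n) []       ys       = refl
take-zipWith f (suc n) (x ∷ xs) []       = refl
take-zipWith f (suc n) (x ∷ xs) (y ∷ ys) = cong (f x y ∷_) (take-zipWith f n xs ys)

drop-zipWith : ∀ {A B C : Set} (f : A → B → C) n xs ys →
  drop n (zipWith f xs ys) ≡ zipWith f (drop n xs) (drop n ys)
drop-zipWith f zero    xs       ys       = refl
drop-zipWith f (suc n) []       ys       = refl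
drop-zipWith f (suc n) (x ∷ xs) []       = sym (zipWith-zeroʳ f (drop n xs))
drop-zipWith f (suc n) (x ∷ xs) (y ∷ ys) = drop-zipWith f n xs ys

-- level xs l is the paper's g_{u_{l+1}} for the gain sequence xs; for l ≥ length xs it is the
-- final level sum xs, so quantifying over all l ranges over exactly the levels of xs.
level : List ℚ → ℕ → ℚ
level xs l = sum (take l xs)

level-[] : ∀ l → level [] l ≡ 0ℚ
level-[] l = cong sum (take-[] l)

level-take : ∀ k xs l → level (take k xs) l ≡ level xs (l ℕ.⊓ k)
level-take k xs l = cong sum (take-take l k xs)

level-+ : ∀ xs n j → level xs (n ℕ.+ j) ≡ level xs n + level (drop n xs) j
level-+ xs       zero    j = sym (+-identityˡ _)
level-+ []       (suc n) j = sym (trans (+-identityˡ _) (level-[] j))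
level-+ (x ∷ xs) (suc n) j = trans (cong (x +_) (level-+ xs n j)) (sym (+-assoc x _ _))

sum≡level+sum-drop : ∀ n xs → sum xs ≡ level xs n + sum (drop n xs)
sum≡level+sum-drop n xs =
  trans (cong sum (sym (take++drop≡id n xs))) (sum-++ (take n xs) (drop n xs))

AllLevels : (ℚ → Set) → List ℚ → Set
AllLevels P xs = ∀ l → P (level xs l)

module _ {P : ℚ → Set} where

  All-scanl⁻ : ∀ a xs → All P (scanl _+_ a xs) → ∀ l → P (a + level xs l)
  All-scanl⁻ a []       (pa ∷ []) l       =
    subst P (sym (trans (cong (a +_) (level-[] l)) (+-identityʳ a))) pa
  All-scanl⁻ a (x ∷ xs) (pa ∷ _)  zero    = subst P (sym (+-identityʳ a)) pa
  All-scanl⁻ a (x ∷ xs) (_ ∷ ps)  (suc l) =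
    subst P (+-assoc a x (level xs l)) (All-scanl⁻ (a + x) xs ps l)

  All-scanl⁺ : ∀ a xs → (∀ l → P (a + level xs l)) → All P (scanl _+_ a xs)
  All-scanl⁺ a []       h = subst P (+-identityʳ a) (h 0) ∷ []
  All-scanl⁺ a (x ∷ xs) h = subst P (+-identityʳ a) (h 0)
    ∷ All-scanl⁺ (a + x) xs (λ l → subst P (sym (+-assoc a x (level xs l))) (h (suc l)))

  allLevels⁻ : ∀ xs → All P (scanl _+_ 0ℚ xs) → AllLevels P xs
  allLevels⁻ xs ps l = subst P (+-identityˡ _) (All-scanl⁻ 0ℚ xs ps l)

  allLevels⁺ : ∀ xs → AllLevels P xs → All P (scanl _+_ 0ℚ xs)
  allLevels⁺ xs h = All-scanl⁺ 0ℚ xs (λ l → subst P (sym (+-identityˡ _)) (h l))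

netGains : List ℚ → List ℚ → List ℚ
netGains = zipWith _-_

netGains-zeroSchedule : ∀ xs → netGains xs (zeroSchedule xs) ≡ xs
netGains-zeroSchedule []       = refl
netGains-zeroSchedule (x ∷ xs) = cong₂ _∷_ (+-identityʳ x) (netGains-zeroSchedule xs)

zeroLevels⁻ : ∀ {P} xs → All P (levels xs (zeroSchedule xs)) → AllLevels P xs
zeroLevels⁻ {P} xs ps =
  allLevels⁻ xs (subst (λ ws → All P (scanl _+_ 0ℚ ws)) (netGains-zeroSchedule xs) ps)

IsAscending IsDescending : List ℚ → Set
IsAscending ws  = AllLevels (λ y → 0ℚ ≤ y × y ≤ sum ws) ws
IsDescending ws = AllLevels (λ y → y ≤ 0ℚ × sum ws ≤ y) ws

Ascending₀ : ℚ → List ℚ → Set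
Ascending₀ B xs = AscendingG B xs (zeroSchedule xs)

module _ {B : ℚ} where

  ascending₀-unfold : ∀ xs →
    Ascending₀ B xs ≡ (TraversableG B xs × All (λ y → 0ℚ ≤ y × y ≤ sum xs) (scanl _+_ 0ℚ xs))
  ascending₀-unfold xs =
    cong (λ ws → TraversableG B xs × All (λ y → 0ℚ ≤ y × y ≤ sum ws) (scanl _+_ 0ℚ ws))
         (netGains-zeroSchedule xs)

  ascending₀⁻ : ∀ xs → Ascending₀ B xs → TraversableG B xs × IsAscending xs
  ascending₀⁻ xs asc with t , ps ← subst id (ascending₀-unfold xs) asc = t , allLevels⁻ xs ps

  ascending₀⁺ : ∀ xs → TraversableG B xs → IsAscending xs → Ascending₀ B xs
  ascending₀⁺ xs t a = subst id (sym (ascending₀-unfold xs)) (t , allLevels⁺ xs a)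

MaxUpTo MinUpTo : List ℚ → ℕ → Set
MaxUpTo xs k = ∀ {l} → l ℕ.≤ k → level xs l ≤ level xs k
MinUpTo xs k = ∀ {l} → l ℕ.≤ k → level xs k ≤ level xs l

drop-preserves-level≤sum : ∀ xs → (∀ l → level xs l ≤ sum xs) →
  ∀ n j → level (drop n xs) j ≤ sum (drop n xs)
drop-preserves-level≤sum xs h n j = +-cancelˡ-≤ (level xs n)
  (subst₂ _≤_ (level-+ xs n j) (sum≡level+sum-drop n xs) (h (n ℕ.+ j)))

drop-preserves-sum≤level : ∀ xs → (∀ l → sum xs ≤ level xs l) →
  ∀ n j → sum (drop n xs) ≤ level (drop n xs) j
drop-preserves-sum≤level xs h n j = +-cancelˡ-≤ (level xs n)
  (subst₂ _≤_ (sum≡level+sum-drop n xs) (level-+ xs n j) (h (n ℕ.+ j)))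

netGains-level≤level : ∀ {xs ds} → All (0ℚ ≤_) ds → length xs ℕ.≤ length ds →
  ∀ l → level (netGains xs ds) l ≤ level xs l
netGains-level≤level {[]}              _            _         _       = ≤-refl
netGains-level≤level {x ∷ xs} {d ∷ ds} _            _         zero    = ≤-refl
netGains-level≤level {x ∷ xs} {d ∷ ds} (0≤d ∷ 0≤ds) (s≤s len) (suc l) =
  +-mono-≤ (p-q≤p x 0≤d) (netGains-level≤level 0≤ds len l)

netGains-preserves-fall : ∀ {xs ds} → All (0ℚ ≤_) ds → length xs ℕ.≤ length ds →
  ∀ {l k} → l ℕ.≤ k → level xs k ≤ level xs l → level (netGains xs ds) k ≤ level (netGains xs ds) l
netGains-preserves-fall 0≤ds len {zero} {k} _ fall = ≤-trans (netGains-level≤level 0≤ds len k) fall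
netGains-preserves-fall {[]} _ _ {suc l} (s≤s _) _ = ≤-refl
netGains-preserves-fall {x ∷ xs} {d ∷ ds} (_ ∷ 0≤ds) (s≤s len) {suc l} (s≤s l≤k) fall =
  +-monoʳ-≤ (x - d) (netGains-preserves-fall 0≤ds len l≤k (+-cancelˡ-≤ x fall))

ascending-take : ∀ {xs} → IsAscending xs → ∀ k → MaxUpTo xs k → IsAscending (take k xs)
ascending-take {xs} asc k max l =
  subst (λ y → 0ℚ ≤ y × y ≤ level xs k) (sym (level-take k xs l))
        (proj₁ (asc (l ℕ.⊓ k)) , max (ℕP.m⊓n≤n l k))

ascending-drop : ∀ {xs} → IsAscending xs → ∀ n → AllLevels (0ℚ ≤_) (drop n xs) →
  IsAscending (drop n xs)
ascending-drop {xs} asc n nonneg j = nonneg j , drop-preserves-level≤sum xs (proj₂ ∘ asc) n j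

descending-take : ∀ {xs ds} → All (0ℚ ≤_) ds → length xs ℕ.≤ length ds →
  IsDescending (netGains xs ds) → ∀ k → MinUpTo xs k → IsDescending (netGains (take k xs) (take k ds))
descending-take {xs} {ds} 0≤ds len desc k min =
  subst IsDescending (take-zipWith _-_ k xs ds) λ l →
    subst (λ y → y ≤ 0ℚ × level ws k ≤ y) (sym (level-take k ws l))
          ( proj₁ (desc (l ℕ.⊓ k))
          , netGains-preserves-fall 0≤ds len (ℕP.m⊓n≤n l k) (min (ℕP.m⊓n≤n l k)))
  where
  ws : List ℚ
  ws = netGains xs ds

descending-drop : ∀ {xs ds} → All (0ℚ ≤_) ds → length xs ℕ.≤ length ds →
  IsDescending (netGains xs ds) → ∀ n → AllLevels (_≤ 0ℚ) (drop n xs) →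
  IsDescending (netGains (drop n xs) (drop n ds))
descending-drop {xs} {ds} 0≤ds len desc n nonpos j =
    ≤-trans (netGains-level≤level (All.drop⁺ n 0≤ds) len′ j) (nonpos j)
  , subst (λ ws → sum ws ≤ level ws j) (drop-zipWith _-_ n xs ds)
          (drop-preserves-sum≤level (netGains xs ds) (proj₂ ∘ desc) n j)
  where
  len′ : length (drop n xs) ℕ.≤ length (drop n ds)
  len′ = subst₂ ℕ._≤_ (sym (length-drop n xs)) (sym (length-drop n ds)) (ℕP.∸-monoˡ-≤ n len)

firstBounded-drop⇒ : ∀ n xs → FirstBoundedG (drop n xs) →
    (AllLevels (0ℚ ≤_) (drop n xs) × AllLevels (_≤ 0ℚ) (drop (suc n) xs))
  ⊎ (AllLevels (0ℚ ≤_) (drop (suc n) xs) × AllLevels (_≤ 0ℚ) (drop n xs))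
firstBounded-drop⇒ zero    []       ()
firstBounded-drop⇒ (suc n) []       ()
firstBounded-drop⇒ (suc n) (x ∷ xs) fb = firstBounded-drop⇒ n xs fb
firstBounded-drop⇒ zero    (x ∷ xs) (inj₁ (_ , bounded)) =
  inj₁ ((proj₁ ∘ h) , (λ l → p+q≤p⇒q≤0 x (proj₂ (h (suc l)))))
  where
  h : AllLevels (λ y → 0ℚ ≤ y × y ≤ x) (x ∷ xs)
  h = zeroLevels⁻ (x ∷ xs) bounded
firstBounded-drop⇒ zero    (x ∷ xs) (inj₂ (_ , bounded)) =
  inj₂ ((λ l → p≤p+q⇒0≤q x (proj₁ (h (suc l)))) , (proj₂ ∘ h))
  where
  h : AllLevels (λ y → x ≤ y × y ≤ 0ℚ) (x ∷ xs)
  h = zeroLevels⁻ (x ∷ xs) bounded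

lastBounded-take⇒ : ∀ {n} xs → n ℕ.< length xs → LastBoundedG (take (suc n) xs) →
  (MaxUpTo xs (suc n) × MinUpTo xs n) ⊎ (MinUpTo xs (suc n) × MaxUpTo xs n)
lastBounded-take⇒ {n} xs n<len (pre , x , T≡ , bounded) = Sum.map rising falling bounded
  where
  T : List ℚ
  T = take (suc n) xs
  bottom : sum pre ≡ level xs n
  bottom = cong sum (take-suc-init xs n<len T≡)
  top : sum pre + x ≡ level xs (suc n)
  top = trans (sym (sum-∷ʳ pre x)) (cong sum (sym T≡))
  onPrefix : ∀ {P} → All P (levels T (zeroSchedule T)) → ∀ {l} → l ℕ.≤ suc n → P (level xs l)
  onPrefix {P} ps {l} l≤ =
    subst P (trans (level-take (suc n) xs l) (cong (level xs) (ℕP.m≤n⇒m⊓n≡m l≤))) (zeroLevels⁻ T ps l)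
  rising : (0ℚ ≤ x) × All (λ y → sum pre ≤ y × y ≤ sum pre + x) (levels T (zeroSchedule T)) →
    MaxUpTo xs (suc n) × MinUpTo xs n
  rising (_ , ps) = (λ l≤ → subst (_ ≤_) top (proj₂ (onPrefix ps l≤)))
                  , (λ l≤ → subst (_≤ _) bottom (proj₁ (onPrefix ps (ℕP.m≤n⇒m≤1+n l≤))))
  falling : (x < 0ℚ) × All (λ y → sum pre + x ≤ y × y ≤ sum pre) (levels T (zeroSchedule T)) →
    MinUpTo xs (suc n) × MaxUpTo xs n
  falling (_ , ps) = (λ l≤ → subst (_≤ _) top (proj₁ (onPrefix ps l≤)))
                   , (λ l≤ → subst (_ ≤_) bottom (proj₂ (onPrefix ps (ℕP.m≤n⇒m≤1+n l≤))))

module _ {B : ℚ} where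

  step-just⁻ : ∀ {b x c} → step B b x ≡ just c → 0ℚ ≤ b + x × (b + x) ⊓ B ≡ c
  step-just⁻ {b} {x} eq with 0ℚ ≤? b + x
  ... | yes 0≤b+x = 0≤b+x , just-injective eq
  step-just⁻ () | no _

  step-just⁺ : ∀ {b x} → 0ℚ ≤ b + x → step B b x ≡ just ((b + x) ⊓ B)
  step-just⁺ {b} {x} 0≤b+x with 0ℚ ≤? b + x
  ... | yes _     = refl
  ... | no ¬0≤b+x = contradiction 0≤b+x ¬0≤b+x

  alpha-bounded : 0ℚ ≤ B → ∀ {b c} xs → 0ℚ ≤ b → b ≤ B → alpha B b xs ≡ just c → 0ℚ ≤ c × c ≤ B
  alpha-bounded _ [] 0≤b b≤B refl = 0≤b , b≤B
  alpha-bounded 0≤B {b} (x ∷ xs) _ _ run with step B b x in eq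
  ... | just c with 0≤b+x , refl ← step-just⁻ eq =
    alpha-bounded 0≤B xs (⊓-glb 0≤b+x 0≤B) (p⊓q≤q (b + x) B) run
  alpha-bounded _ (x ∷ xs) _ _ () | nothing

  alpha-mono : ∀ {b b′ r} xs → b ≤ b′ → alpha B b xs ≡ just r →
    Σ[ r′ ∈ ℚ ] alpha B b′ xs ≡ just r′ × r ≤ r′
  alpha-mono [] b≤b′ refl = _ , refl , b≤b′
  alpha-mono {b} {b′} (x ∷ xs) b≤b′ run with step B b x in eq
  ... | just c with 0≤b+x , refl ← step-just⁻ eq
    with step B b′ x | step-just⁺ {b′} {x} (≤-trans 0≤b+x (+-monoˡ-≤ x b≤b′))
  ...   | _ | refl = alpha-mono xs (⊓-monoˡ-≤ B (+-monoˡ-≤ x b≤b′)) run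
  alpha-mono (x ∷ xs) _ () | nothing

  alpha-split : ∀ {b r} n xs → alpha B b xs ≡ just r →
    Σ[ c ∈ ℚ ] alpha B b (take n xs) ≡ just c × alpha B c (drop n xs) ≡ just r
  alpha-split zero    xs       run = _ , refl , run
  alpha-split (suc n) []       run = _ , refl , run
  alpha-split {b} (suc n) (x ∷ xs) run with step B b x
  ... | just c = alpha-split n xs run
  alpha-split (suc n) (x ∷ xs) () | nothing

  module _ (0≤B : 0ℚ ≤ B) where

    traversable-take : ∀ n xs → TraversableG B xs → TraversableG B (take n xs)
    traversable-take n xs (_ , run , _) =
      let c , prefix , _ = alpha-split n xs run
      in  c , prefix , proj₁ (alpha-bounded 0≤B (take n xs) 0≤B ≤-refl prefix)

    traversable-drop : ∀ n xs → TraversableG B xs → TraversableG B (drop n xs)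
    traversable-drop n xs (_ , run , 0≤r) =
      let c , prefix , suffix = alpha-split n xs run
          c≤B                 = proj₂ (alpha-bounded 0≤B (take n xs) 0≤B ≤-refl prefix)
          r′ , suffix′ , r≤r′ = alpha-mono (drop n xs) c≤B suffix
      in  r′ , suffix′ , ≤-trans 0≤r r≤r′

module _ {B : ℚ} (0≤B : 0ℚ ≤ B) where

  ascending-suffix : ∀ {xs} n → Ascending₀ B xs → FirstBoundedG (drop n xs) →
    Ascending₀ B (drop n xs) ⊎ Ascending₀ B (drop (suc n) xs)
  ascending-suffix {xs} n asc fb with t , a ← ascending₀⁻ xs asc | firstBounded-drop⇒ n xs fb
  ... | inj₁ (nonneg , _) =
    inj₁ (ascending₀⁺ _ (traversable-drop 0≤B n xs t) (ascending-drop a n nonneg))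
  ... | inj₂ (nonneg , _) =
    inj₂ (ascending₀⁺ _ (traversable-drop 0≤B (suc n) xs t) (ascending-drop a (suc n) nonneg))

  ascending-prefix : ∀ {xs} n → n ℕ.< length xs → Ascending₀ B xs → LastBoundedG (take (suc n) xs) →
    Ascending₀ B (take (suc n) xs) ⊎ Ascending₀ B (take n xs)
  ascending-prefix {xs} n n<len asc lb with t , a ← ascending₀⁻ xs asc | lastBounded-take⇒ xs n<len lb
  ... | inj₁ (max , _) =
    inj₁ (ascending₀⁺ _ (traversable-take 0≤B (suc n) xs t) (ascending-take a (suc n) max))
  ... | inj₂ (_ , max) =
    inj₂ (ascending₀⁺ _ (traversable-take 0≤B n xs t) (ascending-take a n max))

  module _ {xs ds : List ℚ} (0≤ds : All (0ℚ ≤_) ds) (len : length xs ℕ.≤ length ds) where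

    descending-suffix : ∀ n → DescendingG B xs ds → FirstBoundedG (drop n xs) →
      DescendingG B (drop n xs) (drop n ds) ⊎ DescendingG B (drop (suc n) xs) (drop (suc n) ds)
    descending-suffix n (t , ps) fb with firstBounded-drop⇒ n xs fb
    ... | inj₁ (_ , nonpos) = inj₂ (traversable-drop 0≤B (suc n) xs t
      , allLevels⁺ _ (descending-drop 0≤ds len (allLevels⁻ _ ps) (suc n) nonpos))
    ... | inj₂ (_ , nonpos) = inj₁ (traversable-drop 0≤B n xs t
      , allLevels⁺ _ (descending-drop 0≤ds len (allLevels⁻ _ ps) n nonpos))

    descending-prefix : ∀ n → n ℕ.< length xs → DescendingG B xs ds → LastBoundedG (take (suc n) xs) →
      DescendingG B (take (suc n) xs) (take (suc n) ds) ⊎ DescendingG B (take n xs) (take n ds)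
    descending-prefix n n<len (t , ps) lb with lastBounded-take⇒ xs n<len lb
    ... | inj₁ (_ , min) = inj₂ (traversable-take 0≤B n xs t
      , allLevels⁺ _ (descending-take 0≤ds len (allLevels⁻ _ ps) n min))
    ... | inj₂ (min , _) = inj₁ (traversable-take 0≤B (suc n) xs t
      , allLevels⁺ _ (descending-take 0≤ds len (allLevels⁻ _ ps) (suc n) min))

-- Everything is read off the gain sequence of P.
module _ (G : Graph) {B : ℚ} (0≤B : 0ℚ ≤ B) (P : List (Edge G)) where

  private
    xs : List ℚ
    xs = gains G P

    firstBounded-sBar : ∀ n → FirstBounded G (sub (suc n) (length P) P) → FirstBoundedG (drop n xs)
    firstBounded-sBar n = subst FirstBoundedG (trans
      (cong (gains G) (take-all (length P ∸ n) (drop n P) (ℕP.≤-reflexive (length-drop n P))))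
      (sym (drop-map n P)))

    lastBounded-sUnder : ∀ n → LastBounded G (sub 1 (suc n) P) → LastBoundedG (take (suc n) xs)
    lastBounded-sUnder n = subst LastBoundedG (sym (take-map (suc n) P))

    index-bound : ∀ {n} → suc n ℕ.< length P → n ℕ.< length xs
    index-bound i<k = subst (_ ℕ.≤_) (sym (length-map (g G) P)) (ℕP.<⇒≤ i<k)

  ascending-subpaths : Ascending G B P (zeroSch G B P) →
    ∀ i → 1 ℕ.< i → i ℕ.< length P →
      (SBar G P i (length P) →
        Ascending G B (drop (i ∸ 1) P) (zeroSch G B (drop (i ∸ 1) P))
        ⊎ Ascending G B (drop i P) (zeroSch G B (drop i P)))
      × (SUnder G P i 1 →
        Ascending G B (take i P) (zeroSch G B (take i P))
        ⊎ Ascending G B (take (i ∸ 1) P) (zeroSch G B (take (i ∸ 1) P)))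
  ascending-subpaths asc (suc n) _ i<k =
      (λ (_ , _ , fb , _) → Sum.map (onDrop n) (onDrop (suc n))
         (ascending-suffix 0≤B n asc (firstBounded-sBar n fb)))
    , (λ (_ , _ , lb , _) → Sum.map (onTake (suc n)) (onTake n)
         (ascending-prefix 0≤B n (index-bound i<k) asc (lastBounded-sUnder n lb)))
    where
    onDrop : ∀ m → Ascending₀ B (drop m xs) → Ascending G B (drop m P) (zeroSch G B (drop m P))
    onDrop m = subst (Ascending₀ B) (drop-map m P)
    onTake : ∀ m → Ascending₀ B (take m xs) → Ascending G B (take m P) (zeroSch G B (take m P))
    onTake m = subst (Ascending₀ B) (take-map m P)

  descending-subpaths : ∀ (ds : List ℚ) → IsSchedule G B P ds → Descending G B P ds →
    ∀ i → 1 ℕ.< i → i ℕ.< length P →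
      (SBar G P i (length P) →
        Descending G B (drop (i ∸ 1) P) (drop (i ∸ 1) ds)
        ⊎ Descending G B (drop i P) (drop i ds))
      × (SUnder G P i 1 →
        Descending G B (take i P) (take i ds)
        ⊎ Descending G B (take (i ∸ 1) P) (take (i ∸ 1) ds))
  descending-subpaths ds (len≡ , 0≤ds) desc (suc n) _ i<k =
      (λ (_ , _ , fb , _) → Sum.map (onDrop n) (onDrop (suc n))
         (descending-suffix 0≤B 0≤ds len n desc (firstBounded-sBar n fb)))
    , (λ (_ , _ , lb , _) → Sum.map (onTake (suc n)) (onTake n)
         (descending-prefix 0≤B 0≤ds len n (index-bound i<k) desc (lastBounded-sUnder n lb)))
    where
    len : length xs ℕ.≤ length ds
    len = ℕP.≤-reflexive (trans (length-map (g G) P) (sym len≡))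
    onDrop : ∀ m → DescendingG B (drop m xs) (drop m ds) → Descending G B (drop m P) (drop m ds)
    onDrop m = subst (λ ys → DescendingG B ys (drop m ds)) (drop-map m P)
    onTake : ∀ m → DescendingG B (take m xs) (take m ds) → Descending G B (take m P) (take m ds)
    onTake m = subst (λ ys → DescendingG B ys (take m ds)) (take-map m P)

mainTheorem11 : (G : Graph) (B : ℚ) → 0ℚ < B →
    (P : List (Edge G)) → IsPath G P →
    -- ascending case (zero schedule)
    (Ascending G B P (zeroSch G B P) →
      ∀ i → 1 ℕ.< i → i ℕ.< length P →
        (SBar G P i (length P) →
          Ascending G B (drop (i ∸ 1) P) (zeroSch G B (drop (i ∸ 1) P))
          ⊎ Ascending G B (drop i P) (zeroSch G B (drop i P)))
        × (SUnder G P i 1 →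
          Ascending G B (take i P) (zeroSch G B (take i P))
          ⊎ Ascending G B (take (i ∸ 1) P) (zeroSch G B (take (i ∸ 1) P))))
    ×
    -- descending case (arbitrary charge drop schedule ds = (d_2,...,d_{k+1}))
    (∀ (ds : List ℚ) → IsSchedule G B P ds → Descending G B P ds →
      ∀ i → 1 ℕ.< i → i ℕ.< length P →
        (SBar G P i (length P) →
          Descending G B (drop (i ∸ 1) P) (drop (i ∸ 1) ds)
          ⊎ Descending G B (drop i P) (drop i ds))
        × (SUnder G P i 1 →
          Descending G B (take i P) (take i ds)
          ⊎ Descending G B (take (i ∸ 1) P) (take (i ∸ 1) ds)))
mainTheorem11 G B 0<B P _ =
  ascending-subpaths G (<⇒≤ 0<B) P , descending-subpaths G (<⇒≤ 0<B) P
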